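{- Let $0<\alpha<1$ and $\beta=1-\alpha$. Consider the Markov chain (the Knödel–Böhm–Hornik walk) on the state space consisting of upper states $U_0,U_1,U_2,\dots$, lower states $L_0,L_1,L_2,\dots$, and two extra states $P$ and $Q$, with the following transition probabilities: - from $U_i$ with $i$ even: to $U_{i+1}$ with probability $\alpha$, and to $U_{i-1}$ with probability $\beta$ if $i\ge 2$, while from $U_0$ one goes to $P$ with probability $\beta$; - from $U_i$ with $i$ odd: to $U_{i+1}$ with probability $\beta$ and to $U_{i-1}$ with probability $\alpha$; - from $P$: to $U_0$ with probability $\beta$ and to $L_1$ with probability $\alpha$; - from $L_i$ with $i$ even: to $L_{i+1}$ with probability $\beta$, and to $L_{i-1}$ with probability $\alpha$ if $i\ge 2$, while from $L_0$ one goes to $Q$ with probability $\alpha$; - from $L_i$ with $i$ odd: to $L_{i+1}$ with probability $\alpha$ and to $L_{i-1}$ with probability $\beta$; - from $Q$: to $L_0$ with probability $\alpha$ and to $U_1$ with probability $\beta$. The chain starts at $X_0=U_0$. For $j\ge 0$ let $$f_j(z)=\sum_{m\ge0}\mathbb{P}\{X_{2m}=U_{2j}\}z^m,\qquad g_j(z)=\sum_{m\ge0}\mathbb{P}\{X_{2m}=L_{2j+1}\}z^m,$$ and $F(u)=\sum_{j\ge0}f_j u^j$, $G(u)=\sum_{j\ge0}g_ju^j$. Let $v=v(z)$ be the unique formal power series with $v(0)=0$ satisfying $z=\dfrac{v}{(\alpha+\beta v)(\beta+\alpha v)}$ (explicitly $v=\frac{1-z(\alpha^2+\beta^2)-\sqrt{(1-z(\alpha^2+\beta^2))^2-4z^2\alpha^2\beta^2}}{2z\alpha\beta}$).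 Then $$F(u)=\frac{(uv^3\beta+\alpha+v\beta)(v\alpha+\beta)}{\alpha\beta(1-uv)(1-v)(v^2+v+1)},\qquad G(u)=\frac{v(\alpha+\alpha v^2+v\beta)(v\alpha+\beta)}{\alpha\beta(1-uv)(1-v)(v^2+v+1)}.$$
   Context: All generating functions are formal power series in $z$ (and $u$); $\mathbb{P}\{X_{2m}=S\}$ denotes the probability that the chain started at $U_0$ is in state $S$ after exactly $2m$ steps.
   Formalization: The parameter α is taken rational, with $0<\alpha<1$. -}

module Defs where

open import Data.Nat using (ℕ; zero; suc; _∸_)
open import Data.Bool using (Bool; true; false; if_then_else_)
open import Data.List using (List; []; _∷_)
open import Data.Product using (_×_; _,_)
open import Data.Rational using (ℚ; 0ℚ; 1ℚ; _+_; _*_; _-_)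

data State : Set where
  U : ℕ → State
  L : ℕ → State
  P : State
  Q : State

isEven : ℕ → Bool
isEven zero = true
isEven (suc n) with isEven n
... | true  = false
... | false = true

eqℕ : ℕ → ℕ → Bool
eqℕ zero    zero    = true
eqℕ zero    (suc _) = false
eqℕ (suc _) zero    = false
eqℕ (suc m) (suc n) = eqℕ m n

eqState : State → State → Bool
eqState (U m) (U n) = eqℕ m n
eqState (L m) (L n) = eqℕ m n
eqState P P = true
eqState Q Q = true
eqState _ _ = false

[_] : Bool → ℚ
[ true ]  = 1ℚ
[ false ] = 0ℚ

trans : ℚ → State → List (State × ℚ)
trans α (U zero) = (U 1 , α) ∷ (P , 1ℚ - α) ∷ []
trans α (U (suc k)) =
  if isEven (suc k)
  then (U (suc (suc k)) , α) ∷ (U k , 1ℚ - α) ∷ []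
  else (U (suc (suc k)) , 1ℚ - α) ∷ (U k , α) ∷ []
trans α P = (U 0 , 1ℚ - α) ∷ (L 1 , α) ∷ []
trans α (L zero) = (L 1 , 1ℚ - α) ∷ (Q , α) ∷ []
trans α (L (suc k)) =
  if isEven (suc k)
  then (L (suc (suc k)) , 1ℚ - α) ∷ (L k , α) ∷ []
  else (L (suc (suc k)) , α) ∷ (L k , 1ℚ - α) ∷ []
trans α Q = (L 0 , α) ∷ (U 1 , 1ℚ - α) ∷ []

-- reach α n s t = P{ X_n = t | X_0 = s }  (n-step transition probability)
reach : ℚ → ℕ → State → State → ℚ
reach α zero    s t = [ eqState s t ]
reach α (suc n) s t = go (trans α s)
  where
  go : List (State × ℚ) → ℚ
  go [] = 0ℚ
  go ((s' , p) ∷ es) = p * reach α n s' t + go es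

Series : Set
Series = ℕ → ℚ

-- bivariate series in z and u: B m j = coefficient of z^m u^j
Series2 : Set
Series2 = ℕ → ℕ → ℚ

sumTo : ℕ → (ℕ → ℚ) → ℚ
sumTo zero    f = f zero
sumTo (suc n) f = sumTo n f + f (suc n)

_+ₛ_ : Series → Series → Series
(a +ₛ b) n = a n + b n

_*ₛ_ : Series → Series → Series
(a *ₛ b) n = sumTo n (λ k → a k * b (n ∸ k))

constₛ : ℚ → Series
constₛ c zero    = c
constₛ c (suc _) = 0ℚ

zₛ : Series
zₛ zero          = 0ℚ
zₛ (suc zero)    = 1ℚ
zₛ (suc (suc _)) = 0ℚ

infixl 6 _+ₛ_
infixl 7 _*ₛ_

_+₂_ : Series2 → Series2 → Series2
(a +₂ b) m j = a m j + b m j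

_-₂_ : Series2 → Series2 → Series2
(a -₂ b) m j = a m j - b m j

_*₂_ : Series2 → Series2 → Series2
(a *₂ b) m j = sumTo m (λ k → sumTo j (λ l → a k l * b (m ∸ k) (j ∸ l)))

infixl 6 _+₂_ _-₂_
infixl 7 _*₂_

const₂ : ℚ → Series2
const₂ c zero    zero    = c
const₂ c _       _       = 0ℚ

u₂ : Series2
u₂ zero (suc zero) = 1ℚ
u₂ _    _          = 0ℚ

lift : Series → Series2
lift a m zero    = a m
lift a m (suc _) = 0ℚ

Fgf : ℚ → Series2
Fgf α m j = reach α (2 Data.Nat.* m) (U 0) (U (2 Data.Nat.* j))

Ggf : ℚ → Series2
Ggf α m j = reach α (2 Data.Nat.* m) (U 0) (L (suc (2 Data.Nat.* j)))

-- Let gf x be the generating function of P{X_{2m} = x} for the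
-- states visited at even times (U_{2j}, L_{2j+1} and Q). Decomposing by the
-- last two steps gives gf x = [x = U₀] + z Σ p q gf y, the sum running over the
-- two-step paths y → · → x with probabilities p, q; a system of this shape has
-- exactly one solution in formal power series. With c = αβ(1 − v)(1 + v + v²)
-- the series c · gf x are therefore the explicit polynomials in v
--   c f₀ = p₀,  c f_{j+1} = v^j (v p₀ + p₁),  c g_j = v^j q₀,  c · gf Q = α v² (αv + β),
-- where p₀ = (α + βv)(αv + β), p₁ = βv³(αv + β), q₀ = v(α + αv² + βv)(αv + β),
-- as each equation of the scaled system becomes a polynomial identity in α, β, v
-- once z is replaced by v / ((α + βv)(β + αv)). Finally, the coefficient of u^j
-- in (1 − uv) F is f_j − v f_{j−1}; multiplied by c these telescope to p₀ and p₁
-- in degrees 0 and 1 and vanish beyond, which is F · D = NF; likewise for G.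

module Submission where

open import Algebra.Bundles using (CommutativeRing)
open import Data.Nat as ℕ using (ℕ; zero; suc; _∸_; _≤_; z≤n)
import Data.Nat.Properties as ℕ
open import Data.Product using (_×_; _,_)

-- Formal power series over a commutative ring

module _ {c ℓ} (R : CommutativeRing c ℓ) where

  open CommutativeRing R

  open import Relation.Binary.Reasoning.Setoid setoid
  open import Algebra.Properties.CommutativeSemigroup *-commutativeSemigroup using (x∙yz≈y∙xz)
  open import Algebra.Properties.CommutativeSemigroup +-commutativeSemigroup using (interchange)

  substitution : ∀ {v z w} a b q l → v ≈ z * w → a ≈ b + q * v → l ≈ q * w → a ≈ b + z * l
  substitution {v} {z} {w} a b q l v≈zw a≈b+qv l≈qw = begin
    a                ≈⟨ a≈b+qv ⟩
    b + q * v        ≈⟨ +-congˡ (*-congˡ v≈zw) ⟩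
    b + q * (z * w)  ≈⟨ +-congˡ (x∙yz≈y∙xz q z w) ⟩
    b + z * (q * w)  ≈⟨ +-congˡ (*-congˡ l≈qw) ⟨
    b + z * l        ∎

  -- The Cauchy product is taken with respect to any operator ∑ obeying the
  -- recursion of finite sums, so that Defs' sumTo and its coefficientwise lift
  -- give rings whose operations are definitionally those of Defs.
  module PowerSeries
    (∑ : ℕ → (ℕ → Carrier) → Carrier)
    (∑-zero : ∀ f → ∑ 0 f ≈ f 0)
    (∑-suc : ∀ n f → ∑ (suc n) f ≈ ∑ n f + f (suc n))
    where

    ∑-cong≤ : ∀ n {f g : ℕ → Carrier} → (∀ k → k ≤ n → f k ≈ g k) → ∑ n f ≈ ∑ n g
    ∑-cong≤ zero {f} {g} f≈g = begin
      ∑ 0 f  ≈⟨ ∑-zero f ⟩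
      f 0    ≈⟨ f≈g 0 z≤n ⟩
      g 0    ≈⟨ ∑-zero g ⟨
      ∑ 0 g  ∎
    ∑-cong≤ (suc n) {f} {g} f≈g = begin
      ∑ (suc n) f          ≈⟨ ∑-suc n f ⟩
      ∑ n f + f (suc n)    ≈⟨ +-cong (∑-cong≤ n (λ k k≤n → f≈g k (ℕ.m≤n⇒m≤1+n k≤n))) (f≈g (suc n) ℕ.≤-refl) ⟩
      ∑ n g + g (suc n)    ≈⟨ ∑-suc n g ⟨
      ∑ (suc n) g          ∎

    ∑-cong : ∀ n {f g : ℕ → Carrier} → (∀ k → f k ≈ g k) → ∑ n f ≈ ∑ n g
    ∑-cong n f≈g = ∑-cong≤ n (λ k _ → f≈g k)

    ∑-distrib-+ : ∀ n (f g : ℕ → Carrier) → ∑ n (λ k → f k + g k) ≈ ∑ n f + ∑ n g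
    ∑-distrib-+ zero f g = trans (∑-zero _) (sym (+-cong (∑-zero f) (∑-zero g)))
    ∑-distrib-+ (suc n) f g = begin
      ∑ (suc n) (λ k → f k + g k)                  ≈⟨ ∑-suc n _ ⟩
      ∑ n (λ k → f k + g k) + (f (suc n) + g (suc n)) ≈⟨ +-congʳ (∑-distrib-+ n f g) ⟩
      (∑ n f + ∑ n g) + (f (suc n) + g (suc n))      ≈⟨ interchange (∑ n f) (∑ n g) (f (suc n)) (g (suc n)) ⟩
      (∑ n f + f (suc n)) + (∑ n g + g (suc n))      ≈⟨ +-cong (∑-suc n f) (∑-suc n g) ⟨
      ∑ (suc n) f + ∑ (suc n) g                      ∎

    ∑-distribˡ-* : ∀ n a (f : ℕ → Carrier) → a * ∑ n f ≈ ∑ n (λ k → a * f k)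
    ∑-distribˡ-* zero a f = trans (*-congˡ (∑-zero f)) (sym (∑-zero _))
    ∑-distribˡ-* (suc n) a f = begin
      a * ∑ (suc n) f                      ≈⟨ *-congˡ (∑-suc n f) ⟩
      a * (∑ n f + f (suc n))              ≈⟨ distribˡ a (∑ n f) (f (suc n)) ⟩
      a * ∑ n f + a * f (suc n)            ≈⟨ +-congʳ (∑-distribˡ-* n a f) ⟩
      ∑ n (λ k → a * f k) + a * f (suc n)  ≈⟨ ∑-suc n _ ⟨
      ∑ (suc n) (λ k → a * f k)            ∎

    ∑-distribʳ-* : ∀ n a (f : ℕ → Carrier) → ∑ n f * a ≈ ∑ n (λ k → f k * a)
    ∑-distribʳ-* n a f = begin
      ∑ n f * a            ≈⟨ *-comm (∑ n f) a ⟩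
      a * ∑ n f            ≈⟨ ∑-distribˡ-* n a f ⟩
      ∑ n (λ k → a * f k)  ≈⟨ ∑-cong n (λ k → *-comm a (f k)) ⟩
      ∑ n (λ k → f k * a)  ∎

    ∑-zeros : ∀ n {f : ℕ → Carrier} → (∀ k → f k ≈ 0#) → ∑ n f ≈ 0#
    ∑-zeros n {f} f≈0 = begin
      ∑ n f                  ≈⟨ ∑-cong n (λ k → trans (f≈0 k) (sym (zeroˡ 0#))) ⟩
      ∑ n (λ _ → 0# * 0#)    ≈⟨ ∑-distribˡ-* n 0# (λ _ → 0#) ⟨
      0# * ∑ n (λ _ → 0#)    ≈⟨ zeroˡ _ ⟩
      0#                     ∎

    ∑-head : ∀ n (f : ℕ → Carrier) → ∑ (suc n) f ≈ f 0 + ∑ n (λ k → f (suc k))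
    ∑-head zero f = begin
      ∑ 1 f                      ≈⟨ ∑-suc 0 f ⟩
      ∑ 0 f + f 1                ≈⟨ +-congʳ (∑-zero f) ⟩
      f 0 + f 1                  ≈⟨ +-congˡ (∑-zero _) ⟨
      f 0 + ∑ 0 (λ k → f (suc k)) ∎
    ∑-head (suc n) f = begin
      ∑ (suc (suc n)) f                                   ≈⟨ ∑-suc (suc n) f ⟩
      ∑ (suc n) f + f (suc (suc n))                       ≈⟨ +-congʳ (∑-head n f) ⟩
      (f 0 + ∑ n (λ k → f (suc k))) + f (suc (suc n))     ≈⟨ +-assoc _ _ _ ⟩
      f 0 + (∑ n (λ k → f (suc k)) + f (suc (suc n)))     ≈⟨ +-congˡ (∑-suc n _) ⟨
      f 0 + ∑ (suc n) (λ k → f (suc k))                   ∎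

    ∑-reverse : ∀ n (f : ℕ → Carrier) → ∑ n f ≈ ∑ n (λ k → f (n ∸ k))
    ∑-reverse zero f = trans (∑-zero f) (sym (∑-zero _))
    ∑-reverse (suc n) f = begin
      ∑ (suc n) f                          ≈⟨ ∑-suc n f ⟩
      ∑ n f + f (suc n)                    ≈⟨ +-comm _ _ ⟩
      f (suc n) + ∑ n f                    ≈⟨ +-congˡ (∑-reverse n f) ⟩
      f (suc n) + ∑ n (λ k → f (n ∸ k))    ≈⟨ ∑-head n (λ k → f (suc n ∸ k)) ⟨
      ∑ (suc n) (λ k → f (suc n ∸ k))      ∎

    ∑-triangle : ∀ n (F : ℕ → ℕ → ℕ → Carrier) →
      ∑ n (λ k → ∑ k (λ i → F i (k ∸ i) (n ∸ k))) ≈ ∑ n (λ i → ∑ (n ∸ i) (λ j → F i j (n ∸ i ∸ j)))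
    ∑-triangle zero F = begin
      ∑ 0 (λ k → ∑ k (λ i → F i (k ∸ i) (0 ∸ k)))  ≈⟨ ∑-zero _ ⟩
      ∑ 0 (λ i → F i (0 ∸ i) 0)                      ≈⟨ ∑-zero _ ⟩
      F 0 0 0                                         ≈⟨ ∑-zero _ ⟨
      ∑ 0 (λ j → F 0 j (0 ∸ j))                      ≈⟨ ∑-zero _ ⟨
      ∑ 0 (λ i → ∑ (0 ∸ i) (λ j → F i j (0 ∸ i ∸ j))) ∎
    ∑-triangle (suc n) F = begin
      ∑ (suc n) (λ k → ∑ k (λ i → F i (k ∸ i) (suc n ∸ k)))
        ≈⟨ ∑-head n _ ⟩
      ∑ 0 (λ i → F i (0 ∸ i) (suc n)) + ∑ n (λ k → ∑ (suc k) (λ i → F i (suc k ∸ i) (n ∸ k)))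
        ≈⟨ +-cong (∑-zero _) (∑-cong n (λ k → ∑-head k _)) ⟩
      F 0 0 (suc n) + ∑ n (λ k → F 0 (suc k) (n ∸ k) + ∑ k (λ i → F (suc i) (k ∸ i) (n ∸ k)))
        ≈⟨ +-congˡ (∑-distrib-+ n _ _) ⟩
      F 0 0 (suc n) + (∑ n (λ k → F 0 (suc k) (n ∸ k)) + ∑ n (λ k → ∑ k (λ i → F (suc i) (k ∸ i) (n ∸ k))))
        ≈⟨ +-assoc _ _ _ ⟨
      (F 0 0 (suc n) + ∑ n (λ k → F 0 (suc k) (n ∸ k))) + ∑ n (λ k → ∑ k (λ i → F (suc i) (k ∸ i) (n ∸ k)))
        ≈⟨ +-cong (∑-head n (λ j → F 0 j (suc n ∸ j))) (sym (∑-triangle n (λ i → F (suc i)))) ⟨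
      ∑ (suc n) (λ j → F 0 j (suc n ∸ j)) + ∑ n (λ i → ∑ (n ∸ i) (λ j → F (suc i) j (n ∸ i ∸ j)))
        ≈⟨ ∑-head n _ ⟨
      ∑ (suc n) (λ i → ∑ (suc n ∸ i) (λ j → F i j (suc n ∸ i ∸ j))) ∎

    infix  4 _≈ˢ_
    infixl 6 _+ˢ_
    infixl 7 _*ˢ_

    _≈ˢ_ : (ℕ → Carrier) → (ℕ → Carrier) → Set ℓ
    a ≈ˢ b = ∀ n → a n ≈ b n

    _+ˢ_ _*ˢ_ : (ℕ → Carrier) → (ℕ → Carrier) → (ℕ → Carrier)
    (a +ˢ b) n = a n + b n
    (a *ˢ b) n = ∑ n (λ k → a k * b (n ∸ k))

    -ˢ_ : (ℕ → Carrier) → (ℕ → Carrier)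
    (-ˢ a) n = - a n

    κ : Carrier → (ℕ → Carrier)
    κ a zero    = a
    κ a (suc _) = 0#

    X : ℕ → Carrier
    X zero          = 0#
    X (suc zero)    = 1#
    X (suc (suc _)) = 0#

    *ˢ-cong : ∀ {a a′ b b′} → a ≈ˢ a′ → b ≈ˢ b′ → a *ˢ b ≈ˢ a′ *ˢ b′
    *ˢ-cong a≈a′ b≈b′ n = ∑-cong n (λ k → *-cong (a≈a′ k) (b≈b′ (n ∸ k)))

    *ˢ-congʳ : ∀ {a a′} b → a ≈ˢ a′ → a *ˢ b ≈ˢ a′ *ˢ b
    *ˢ-congʳ b a≈a′ = *ˢ-cong {b = b} {b′ = b} a≈a′ (λ _ → refl)

    *ˢ-comm : ∀ a b → a *ˢ b ≈ˢ b *ˢ a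
    *ˢ-comm a b n = begin
      ∑ n (λ k → a k * b (n ∸ k))                ≈⟨ ∑-reverse n _ ⟩
      ∑ n (λ k → a (n ∸ k) * b (n ∸ (n ∸ k)))    ≈⟨ ∑-cong≤ n swap ⟩
      ∑ n (λ k → b k * a (n ∸ k))                ∎
      where
      swap : ∀ k → k ≤ n → a (n ∸ k) * b (n ∸ (n ∸ k)) ≈ b k * a (n ∸ k)
      swap k k≤n rewrite ℕ.m∸[m∸n]≡n k≤n = *-comm (a (n ∸ k)) (b k)

    *ˢ-assoc : ∀ a b d → (a *ˢ b) *ˢ d ≈ˢ a *ˢ (b *ˢ d)
    *ˢ-assoc a b d n = begin
      ∑ n (λ k → ∑ k (λ i → a i * b (k ∸ i)) * d (n ∸ k))         ≈⟨ ∑-cong n (λ k → ∑-distribʳ-* k _ _) ⟩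
      ∑ n (λ k → ∑ k (λ i → (a i * b (k ∸ i)) * d (n ∸ k)))       ≈⟨ ∑-triangle n (λ i j l → (a i * b j) * d l) ⟩
      ∑ n (λ i → ∑ (n ∸ i) (λ j → (a i * b j) * d (n ∸ i ∸ j)))   ≈⟨ ∑-cong n (λ i → ∑-cong (n ∸ i) (λ j → *-assoc _ _ _)) ⟩
      ∑ n (λ i → ∑ (n ∸ i) (λ j → a i * (b j * d (n ∸ i ∸ j))))   ≈⟨ ∑-cong n (λ i → ∑-distribˡ-* (n ∸ i) _ _) ⟨
      ∑ n (λ i → a i * ∑ (n ∸ i) (λ j → b j * d (n ∸ i ∸ j)))     ∎

    κ-*ˢ : ∀ a b → κ a *ˢ b ≈ˢ (λ n → a * b n)
    κ-*ˢ a b zero = ∑-zero _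
    κ-*ˢ a b (suc n) = begin
      ∑ (suc n) (λ k → κ a k * b (suc n ∸ k))          ≈⟨ ∑-head n _ ⟩
      a * b (suc n) + ∑ n (λ k → 0# * b (n ∸ k))       ≈⟨ +-congˡ (∑-zeros n (λ k → zeroˡ _)) ⟩
      a * b (suc n) + 0#                               ≈⟨ +-identityʳ _ ⟩
      a * b (suc n)                                    ∎

    X-*ˢ-suc : ∀ b n → (X *ˢ b) (suc n) ≈ b n
    X-*ˢ-suc b n = begin
      ∑ (suc n) (λ k → X k * b (suc n ∸ k))                  ≈⟨ ∑-head n _ ⟩
      0# * b (suc n) + ∑ n (λ k → X (suc k) * b (n ∸ k))     ≈⟨ +-cong (zeroˡ _) (∑-cong n (λ k → *-congʳ (X-suc k))) ⟩
      0# + (κ 1# *ˢ b) n                                     ≈⟨ +-identityˡ _ ⟩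
      (κ 1# *ˢ b) n                                          ≈⟨ κ-*ˢ 1# b n ⟩
      1# * b n                                               ≈⟨ *-identityˡ _ ⟩
      b n                                                    ∎
      where
      X-suc : ∀ k → X (suc k) ≈ κ 1# k
      X-suc zero    = refl
      X-suc (suc k) = refl

    seriesRing : CommutativeRing c ℓ
    seriesRing = record
      { Carrier = ℕ → Carrier
      ; _≈_ = _≈ˢ_
      ; _+_ = _+ˢ_
      ; _*_ = _*ˢ_
      ; -_ = -ˢ_
      ; 0# = κ 0#
      ; 1# = κ 1#
      ; isCommutativeRing = record
        { isRing = record
          { +-isAbelianGroup = record
            { isGroup = record
              { isMonoid = record
                { isSemigroup = record
                  { isMagma = record
                    { isEquivalence = record
                      { refl = λ n → refl ; sym = λ a≈b n → sym (a≈b n) ; trans = λ a≈b b≈d n → trans (a≈b n) (b≈d n) }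
                    ; ∙-cong = λ a≈a′ b≈b′ n → +-cong (a≈a′ n) (b≈b′ n) }
                  ; assoc = λ a b d n → +-assoc (a n) (b n) (d n) }
                ; identity = +-identityˡ-ˢ , +-identityʳ-ˢ }
              ; inverse = -‿inverseˡ-ˢ , -‿inverseʳ-ˢ
              ; ⁻¹-cong = λ a≈b n → -‿cong (a≈b n) }
            ; comm = λ a b n → +-comm (a n) (b n) }
          ; *-cong = *ˢ-cong
          ; *-assoc = *ˢ-assoc
          ; *-identity = *ˢ-identityˡ , (λ a n → trans (*ˢ-comm a (κ 1#) n) (*ˢ-identityˡ a n))
          ; distrib = *ˢ-distribˡ , (λ a b d n → trans (*ˢ-comm (b +ˢ d) a n)
                                      (trans (*ˢ-distribˡ a b d n) (+-cong (*ˢ-comm a b n) (*ˢ-comm a d n)))) }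
        ; *-comm = *ˢ-comm }
      }
      where
      +-identityˡ-ˢ : ∀ a → κ 0# +ˢ a ≈ˢ a
      +-identityˡ-ˢ a zero    = +-identityˡ (a 0)
      +-identityˡ-ˢ a (suc n) = +-identityˡ (a (suc n))
      +-identityʳ-ˢ : ∀ a → a +ˢ κ 0# ≈ˢ a
      +-identityʳ-ˢ a zero    = +-identityʳ (a 0)
      +-identityʳ-ˢ a (suc n) = +-identityʳ (a (suc n))
      -‿inverseˡ-ˢ : ∀ a → (-ˢ a) +ˢ a ≈ˢ κ 0#
      -‿inverseˡ-ˢ a zero    = -‿inverseˡ (a 0)
      -‿inverseˡ-ˢ a (suc n) = -‿inverseˡ (a (suc n))
      -‿inverseʳ-ˢ : ∀ a → a +ˢ (-ˢ a) ≈ˢ κ 0#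
      -‿inverseʳ-ˢ a zero    = -‿inverseʳ (a 0)
      -‿inverseʳ-ˢ a (suc n) = -‿inverseʳ (a (suc n))
      *ˢ-identityˡ : ∀ a → κ 1# *ˢ a ≈ˢ a
      *ˢ-identityˡ a n = trans (κ-*ˢ 1# a n) (*-identityˡ (a n))
      *ˢ-distribˡ : ∀ a b d → a *ˢ (b +ˢ d) ≈ˢ a *ˢ b +ˢ a *ˢ d
      *ˢ-distribˡ a b d n = trans (∑-cong n (λ k → distribˡ _ _ _)) (∑-distrib-+ n _ _)

    κ-* : ∀ a b → κ (a * b) ≈ˢ κ a *ˢ κ b
    κ-* a b zero    = sym (κ-*ˢ a (κ b) 0)
    κ-* a b (suc n) = sym (trans (κ-*ˢ a (κ b) (suc n)) (zeroʳ a))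

    κ-cong : ∀ {a b} → a ≈ b → κ a ≈ˢ κ b
    κ-cong a≈b zero    = a≈b
    κ-cong a≈b (suc n) = refl

open import Defs
open import Relation.Binary.PropositionalEquality as ≡ using (_≡_; refl; cong; cong₂)
open import Data.Bool using (true; false)
open import Data.List using (List; []; _∷_)
open import Data.List.Relation.Unary.All using (All; []; _∷_)
open import Data.Sum using (_⊎_; inj₁; inj₂)
open import Data.Maybe using (Maybe; just; nothing)
open import Data.Vec using (Vec; []; _∷_)
open import Data.Fin using (zero; suc)
open import Data.Rational as ℚ using (ℚ; 0ℚ; 1ℚ; _<_; _+_; _*_; _-_; -_)
import Data.Rational.Properties as ℚ
open import Data.Rational.Solver using (module +-*-Solver)
open import Relation.Nullary using (yes; no)
open import Algebra.Solver.Ring.AlmostCommutativeRing using (_-Raw-AlmostCommutative⟶_; module _-Raw-AlmostCommutative⟶_; fromCommutativeRing)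
import Algebra.Solver.Ring as RingSolver

sumTo-zero : ∀ f → sumTo 0 f ≡ f 0
sumTo-zero f = refl

sumTo-suc : ∀ n f → sumTo (suc n) f ≡ sumTo n f + f (suc n)
sumTo-suc n f = refl

module Ser = PowerSeries ℚ.+-*-commutativeRing sumTo sumTo-zero sumTo-suc

Series-ring : CommutativeRing _ _
Series-ring = Ser.seriesRing

-- Series2 m j is the coefficient of z^m u^j: a bivariate series is a power
-- series in z whose coefficients are series in u.
sumTo₂ : ℕ → (ℕ → Series) → Series
sumTo₂ m F j = sumTo m (λ k → F k j)

sumTo₂-zero : ∀ F j → sumTo₂ 0 F j ≡ F 0 j
sumTo₂-zero F j = refl

sumTo₂-suc : ∀ m F j → sumTo₂ (suc m) F j ≡ (sumTo₂ m F +ₛ F (suc m)) j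
sumTo₂-suc m F j = refl

module Ser₂ = PowerSeries Series-ring sumTo₂ sumTo₂-zero sumTo₂-suc

Series2-ring : CommutativeRing _ _
Series2-ring = Ser₂.seriesRing

open CommutativeRing Series-ring using (_≈_)
open CommutativeRing Series2-ring using () renaming (_≈_ to _≈₂_)

constₛ≈κ : ∀ x n → constₛ x n ≡ Ser.κ x n
constₛ≈κ x zero    = refl
constₛ≈κ x (suc n) = refl

const₂≈κκ : ∀ x m j → const₂ x m j ≡ Ser₂.κ (Ser.κ x) m j
const₂≈κκ x zero    zero    = refl
const₂≈κκ x zero    (suc j) = refl
const₂≈κκ x (suc m) zero    = refl
const₂≈κκ x (suc m) (suc j) = refl

constₛ-morphism : CommutativeRing.rawRing ℚ.+-*-commutativeRing -Raw-AlmostCommutative⟶ fromCommutativeRing Series-ring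
constₛ-morphism = record
  { ⟦_⟧    = constₛ
  ; +-homo = +-homo
  ; *-homo = *-homo
  ; -‿homo = -‿homo
  ; 0-homo = constₛ≈κ 0ℚ
  ; 1-homo = constₛ≈κ 1ℚ
  }
  where
  +-homo : ∀ x y → constₛ (x + y) ≈ constₛ x +ₛ constₛ y
  +-homo x y zero    = refl
  +-homo x y (suc n) = refl
  -‿homo : ∀ x → constₛ (- x) ≈ (λ n → - constₛ x n)
  -‿homo x zero    = refl
  -‿homo x (suc n) = refl
  *-homo : ∀ x y → constₛ (x * y) ≈ constₛ x *ₛ constₛ y
  *-homo x y n = ≡.trans (constₛ≈κ (x * y) n) (≡.trans (Ser.κ-* x y n)
                   (Ser.*ˢ-cong (λ k → ≡.sym (constₛ≈κ x k)) (λ k → ≡.sym (constₛ≈κ y k)) n))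

const₂-morphism : CommutativeRing.rawRing ℚ.+-*-commutativeRing -Raw-AlmostCommutative⟶ fromCommutativeRing Series2-ring
const₂-morphism = record
  { ⟦_⟧    = const₂
  ; +-homo = +-homo
  ; *-homo = *-homo
  ; -‿homo = -‿homo
  ; 0-homo = const₂≈κκ 0ℚ
  ; 1-homo = const₂≈κκ 1ℚ
  }
  where
  open import Relation.Binary.Reasoning.Setoid (CommutativeRing.setoid Series2-ring)
  +-homo : ∀ x y → const₂ (x + y) ≈₂ const₂ x +₂ const₂ y
  +-homo x y zero    zero    = refl
  +-homo x y zero    (suc j) = refl
  +-homo x y (suc m) zero    = refl
  +-homo x y (suc m) (suc j) = refl
  -‿homo : ∀ x → const₂ (- x) ≈₂ (λ m j → - const₂ x m j)
  -‿homo x zero    zero    = refl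
  -‿homo x zero    (suc j) = refl
  -‿homo x (suc m) zero    = refl
  -‿homo x (suc m) (suc j) = refl
  *-homo : ∀ x y → const₂ (x * y) ≈₂ const₂ x *₂ const₂ y
  *-homo x y = begin
    const₂ (x * y)                            ≈⟨ const₂≈κκ (x * y) ⟩
    κ₂ (Ser.κ (x * y))                        ≈⟨ Ser₂.κ-cong (Ser.κ-* x y) ⟩
    κ₂ (Ser.κ x Ser.*ˢ Ser.κ y)               ≈⟨ Ser₂.κ-* (Ser.κ x) (Ser.κ y) ⟩
    κ₂ (Ser.κ x) *₂ κ₂ (Ser.κ y)              ≈⟨ Ser₂.*ˢ-cong (λ m j → ≡.sym (const₂≈κκ x m j)) (λ m j → ≡.sym (const₂≈κκ y m j)) ⟩
    const₂ x *₂ const₂ y                      ∎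
    where κ₂ = Ser₂.κ

constₛ-≟ : ∀ x y → Maybe (∀ n → constₛ x n ≡ constₛ y n)
constₛ-≟ x y with x ℚ.≟ y
... | yes refl = just (λ n → refl)
... | no _     = nothing

const₂-≟ : ∀ x y → Maybe (∀ m j → const₂ x m j ≡ const₂ y m j)
const₂-≟ x y with x ℚ.≟ y
... | yes refl = just (λ m j → refl)
... | no _     = nothing

module SeriesSolver = RingSolver (CommutativeRing.rawRing ℚ.+-*-commutativeRing) (fromCommutativeRing Series-ring) constₛ-morphism constₛ-≟
module Series2Solver = RingSolver (CommutativeRing.rawRing ℚ.+-*-commutativeRing) (fromCommutativeRing Series2-ring) const₂-morphism const₂-≟

+ₛ-congˡ : ∀ a {b b′} → b ≈ b′ → a +ₛ b ≈ a +ₛ b′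
+ₛ-congˡ a = CommutativeRing.+-congˡ Series-ring {a}

*ₛ-congˡ : ∀ a {b b′} → b ≈ b′ → a *ₛ b ≈ a *ₛ b′
*ₛ-congˡ a = CommutativeRing.*-congˡ Series-ring {a}

*ₛ-congʳ : ∀ b {a a′} → a ≈ a′ → a *ₛ b ≈ a′ *ₛ b
*ₛ-congʳ b = CommutativeRing.*-congʳ Series-ring {b}

+ₛ-congʳ : ∀ b {a a′} → a ≈ a′ → a +ₛ b ≈ a′ +ₛ b
+ₛ-congʳ b = CommutativeRing.+-congʳ Series-ring {b}

constₛ-*ₛ : ∀ p Y n → (constₛ p *ₛ Y) n ≡ p * Y n
constₛ-*ₛ p Y n = ≡.trans (Ser.*ˢ-congʳ Y (constₛ≈κ p) n) (Ser.κ-*ˢ p Y n)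

zₛ-*ₛ-zero : ∀ Y → (zₛ *ₛ Y) 0 ≡ 0ℚ
zₛ-*ₛ-zero Y = ℚ.*-zeroˡ (Y 0)

zₛ-*ₛ-suc : ∀ Y n → (zₛ *ₛ Y) (suc n) ≡ Y n
zₛ-*ₛ-suc Y n = ≡.trans (Ser.*ˢ-congʳ Y zₛ≈X (suc n)) (Ser.X-*ˢ-suc Y n)
  where
  zₛ≈X : ∀ k → zₛ k ≡ Ser.X k
  zₛ≈X zero          = refl
  zₛ≈X (suc zero)    = refl
  zₛ≈X (suc (suc k)) = refl

-- Last-step decomposition of the walk

expect : List (State × ℚ) → (State → ℚ) → ℚ
expect []               g = 0ℚ
expect ((s , p) ∷ out) g = p * g s + expect out g

sumOver : List State → (State → ℚ) → ℚ
sumOver []       f = 0ℚ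
sumOver (t ∷ ts) f = f t + sumOver ts f

reach-suc : ∀ α n s t → reach α (suc n) s t ≡ expect (trans α s) (λ s′ → reach α n s′ t)
reach-suc α n (U zero) t = refl
reach-suc α n (U (suc k)) t with isEven (suc k)
... | true  = refl
... | false = refl
reach-suc α n (L zero) t = refl
reach-suc α n (L (suc k)) t with isEven (suc k)
... | true  = refl
... | false = refl
reach-suc α n P t = refl
reach-suc α n Q t = refl

sumOver-cong : ∀ ts {f g : State → ℚ} → (∀ t → f t ≡ g t) → sumOver ts f ≡ sumOver ts g
sumOver-cong []       f≡g = refl
sumOver-cong (t ∷ ts) f≡g = cong₂ _+_ (f≡g t) (sumOver-cong ts f≡g)

expect-cong : ∀ out {f g : State → ℚ} → (∀ s → f s ≡ g s) → expect out f ≡ expect out g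
expect-cong []              f≡g = refl
expect-cong ((s , p) ∷ out) f≡g = cong₂ _+_ (cong (p *_) (f≡g s)) (expect-cong out f≡g)

expect-*ʳ : ∀ out (g : State → ℚ) w → expect out (λ s → g s * w) ≡ expect out g * w
expect-*ʳ []              g w = ≡.sym (ℚ.*-zeroˡ w)
expect-*ʳ ((s , p) ∷ out) g w = begin
  p * (g s * w) + expect out (λ s → g s * w)  ≡⟨ cong (p * (g s * w) +_) (expect-*ʳ out g w) ⟩
  p * (g s * w) + expect out g * w            ≡⟨ solve 4 (λ p x w e → p :* (x :* w) :+ e :* w := (p :* x :+ e) :* w) refl p (g s) w (expect out g) ⟩
  (p * g s + expect out g) * w                ∎
  where
  open +-*-Solver
  open ≡.≡-Reasoning

expect-sumOver : ∀ out ts (h : State → State → ℚ) →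
  expect out (λ s → sumOver ts (h s)) ≡ sumOver ts (λ t → expect out (λ s → h s t))
expect-sumOver out []       h = expect-zero out
  where
  expect-zero : ∀ out → expect out (λ _ → 0ℚ) ≡ 0ℚ
  expect-zero []              = refl
  expect-zero ((s , p) ∷ out) rewrite expect-zero out | ℚ.*-zeroʳ p = refl
expect-sumOver out (t ∷ ts) h = begin
  expect out (λ s → h s t + sumOver ts (h s))                      ≡⟨ expect-+ out _ _ ⟩
  expect out (λ s → h s t) + expect out (λ s → sumOver ts (h s))   ≡⟨ cong (expect out (λ s → h s t) +_) (expect-sumOver out ts h) ⟩
  expect out (λ s → h s t) + sumOver ts (λ t → expect out (λ s → h s t)) ∎
  where
  open ≡.≡-Reasoning
  expect-+ : ∀ out (f g : State → ℚ) → expect out (λ s → f s + g s) ≡ expect out f + expect out g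
  expect-+ []              f g = refl
  expect-+ ((s , p) ∷ out) f g rewrite expect-+ out f g =
    solve 5 (λ p x y e d → p :* (x :+ y) :+ (e :+ d) := (p :* x :+ e) :+ (p :* y :+ d)) refl p (f s) (g s) (expect out f) (expect out g)
    where open +-*-Solver

preds : State → List State
preds (U zero)          = U 1 ∷ P ∷ []
preds (U (suc zero))    = U 0 ∷ U 2 ∷ Q ∷ []
preds (U (suc (suc k))) = U (suc k) ∷ U (suc (suc (suc k))) ∷ []
preds P                 = U 0 ∷ []
preds (L zero)          = L 1 ∷ Q ∷ []
preds (L (suc zero))    = L 0 ∷ L 2 ∷ P ∷ []
preds (L (suc (suc k))) = L (suc k) ∷ L (suc (suc (suc k))) ∷ []
preds Q                 = L 0 ∷ []

count : State → List State → ℚ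
count s ts = sumOver ts (λ t → [ eqState s t ])

eqℕ-sound : ∀ m n → eqℕ m n ≡ true → m ≡ n
eqℕ-sound zero    zero    _ = refl
eqℕ-sound (suc m) (suc n) e = cong suc (eqℕ-sound m n e)

eqℕ-refl : ∀ n → eqℕ n n ≡ true
eqℕ-refl zero    = refl
eqℕ-refl (suc n) = eqℕ-refl n

eqℕ-n-2+n : ∀ n → eqℕ n (suc (suc n)) ≡ false
eqℕ-n-2+n zero    = refl
eqℕ-n-2+n (suc n) = eqℕ-n-2+n n

eqℕ-2+n-n : ∀ n → eqℕ (suc (suc n)) n ≡ false
eqℕ-2+n-n zero    = refl
eqℕ-2+n-n (suc n) = eqℕ-2+n-n n

eqState-sound : ∀ s t → eqState s t ≡ true → s ≡ t
eqState-sound (U m) (U n) e = cong U (eqℕ-sound m n e)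
eqState-sound (L m) (L n) e = cong L (eqℕ-sound m n e)
eqState-sound P     P     _ = refl
eqState-sound Q     Q     _ = refl
eqState-sound (U _) (L _) ()
eqState-sound (U _) P     ()
eqState-sound (U _) Q     ()
eqState-sound (L _) (U _) ()
eqState-sound (L _) P     ()
eqState-sound (L _) Q     ()
eqState-sound P     (U _) ()
eqState-sound P     (L _) ()
eqState-sound P     Q     ()
eqState-sound Q     (U _) ()
eqState-sound Q     (L _) ()
eqState-sound Q     P     ()

sumOver-indicator : ∀ s ts (r : State → ℚ) → sumOver ts (λ t → [ eqState s t ] * r t) ≡ count s ts * r s
sumOver-indicator s []       r = ≡.sym (ℚ.*-zeroˡ (r s))
sumOver-indicator s (t ∷ ts) r with eqState s t in s≟t
... | true  rewrite eqState-sound s t s≟t | sumOver-indicator t ts r =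
  solve 2 (λ x c → con 1ℚ :* x :+ c :* x := (con 1ℚ :+ c) :* x) refl (r t) (count t ts)
  where open +-*-Solver
... | false rewrite sumOver-indicator s ts r =
  solve 3 (λ y x c → con 0ℚ :* y :+ c :* x := (con 0ℚ :+ c) :* x) refl (r t) (r s) (count s ts)
  where open +-*-Solver

ListedIn : State → State × ℚ → Set
ListedIn s (t , _) = count s (preds t) ≡ 1ℚ

count-U-up : ∀ k → count (U (suc k)) (preds (U (suc (suc k)))) ≡ 1ℚ
count-U-up k rewrite eqℕ-refl k | eqℕ-n-2+n k = refl

count-U-down : ∀ k → count (U (suc k)) (preds (U k)) ≡ 1ℚ
count-U-down zero          = refl
count-U-down (suc zero)    = refl
count-U-down (suc (suc k)) rewrite eqℕ-2+n-n k | eqℕ-refl k = refl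

count-L-up : ∀ k → count (L (suc k)) (preds (L (suc (suc k)))) ≡ 1ℚ
count-L-up k rewrite eqℕ-refl k | eqℕ-n-2+n k = refl

count-L-down : ∀ k → count (L (suc k)) (preds (L k)) ≡ 1ℚ
count-L-down zero          = refl
count-L-down (suc zero)    = refl
count-L-down (suc (suc k)) rewrite eqℕ-2+n-n k | eqℕ-refl k = refl

preds-complete : ∀ α s → All (ListedIn s) (trans α s)
preds-complete α (U zero) = refl ∷ refl ∷ []
preds-complete α (U (suc k)) with isEven (suc k)
... | true  = count-U-up k ∷ count-U-down k ∷ []
... | false = count-U-up k ∷ count-U-down k ∷ []
preds-complete α (L zero) = refl ∷ refl ∷ []
preds-complete α (L (suc k)) with isEven (suc k)
... | true  = count-L-up k ∷ count-L-down k ∷ []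
... | false = count-L-up k ∷ count-L-down k ∷ []
preds-complete α P = refl ∷ refl ∷ []
preds-complete α Q = refl ∷ refl ∷ []

listed-or-unreachable : ∀ {s t} out → All (ListedIn s) out →
  count s (preds t) ≡ 1ℚ ⊎ expect out (λ s′ → [ eqState s′ t ]) ≡ 0ℚ
listed-or-unreachable [] [] = inj₂ refl
listed-or-unreachable {s} {t} ((s′ , p) ∷ out) (listed ∷ listeds) with eqState s′ t in s′≟t
... | true  = inj₁ (≡.subst (λ x → count s (preds x) ≡ 1ℚ) (eqState-sound s′ t s′≟t) listed)
... | false with listed-or-unreachable {s} {t} out listeds
...   | inj₁ once = inj₁ once
...   | inj₂ none rewrite ℚ.*-zeroʳ p | none = inj₂ refl

-- Either t is a successor of s, and then s occurs exactly once in preds t, or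
-- reach α 1 s t vanishes.
reach-one-backward : ∀ α s t → reach α 1 s t ≡ sumOver (preds t) (λ t′ → reach α 0 s t′ * reach α 1 t′ t)
reach-one-backward α s t = begin
  reach α 1 s t                                  ≡⟨ absorb (listed-or-unreachable {s} {t} (trans α s) (preds-complete α s)) ⟩
  count s (preds t) * reach α 1 s t              ≡⟨ sumOver-indicator s (preds t) (λ t′ → reach α 1 t′ t) ⟨
  sumOver (preds t) (λ t′ → [ eqState s t′ ] * reach α 1 t′ t) ∎
  where
  open ≡.≡-Reasoning
  absorb : count s (preds t) ≡ 1ℚ ⊎ expect (trans α s) (λ s′ → [ eqState s′ t ]) ≡ 0ℚ →
           reach α 1 s t ≡ count s (preds t) * reach α 1 s t
  absorb (inj₁ once) rewrite once = ≡.sym (ℚ.*-identityˡ _)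
  absorb (inj₂ none) rewrite reach-suc α 0 s t | none = ≡.sym (ℚ.*-zeroʳ (count s (preds t)))

reach-backward : ∀ α n s t → reach α (suc n) s t ≡ sumOver (preds t) (λ t′ → reach α n s t′ * reach α 1 t′ t)
reach-backward α zero    s t = reach-one-backward α s t
reach-backward α (suc n) s t = begin
  reach α (suc (suc n)) s t
    ≡⟨ reach-suc α (suc n) s t ⟩
  expect (trans α s) (λ s′ → reach α (suc n) s′ t)
    ≡⟨ expect-cong (trans α s) (λ s′ → reach-backward α n s′ t) ⟩
  expect (trans α s) (λ s′ → sumOver (preds t) (λ t′ → reach α n s′ t′ * reach α 1 t′ t))
    ≡⟨ expect-sumOver (trans α s) (preds t) _ ⟩
  sumOver (preds t) (λ t′ → expect (trans α s) (λ s′ → reach α n s′ t′ * reach α 1 t′ t))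
    ≡⟨ sumOver-cong (preds t) (λ t′ → expect-*ʳ (trans α s) (λ s′ → reach α n s′ t′) (reach α 1 t′ t)) ⟩
  sumOver (preds t) (λ t′ → expect (trans α s) (λ s′ → reach α n s′ t′) * reach α 1 t′ t)
    ≡⟨ sumOver-cong (preds t) (λ t′ → cong (_* reach α 1 t′ t) (reach-suc α n s t′)) ⟨
  sumOver (preds t) (λ t′ → reach α (suc n) s t′ * reach α 1 t′ t) ∎
  where open ≡.≡-Reasoning

reach-two-backward : ∀ α n s t → reach α (suc (suc n)) s t ≡
  sumOver (preds t) (λ t′ → sumOver (preds t′) (λ t″ → reach α n s t″ * reach α 1 t″ t′) * reach α 1 t′ t)
reach-two-backward α n s t = ≡.trans (reach-backward α (suc n) s t)
  (sumOver-cong (preds t) (λ t′ → cong (_* reach α 1 t′ t) (reach-backward α n s t′)))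

-- Two-step recurrences at even times

twice : ℕ → ℕ
twice zero    = zero
twice (suc j) = suc (suc (twice j))

isEven-twice : ∀ j → isEven (twice j) ≡ true
isEven-twice zero = refl
isEven-twice (suc j) rewrite isEven-twice j = refl

data EvenState : Set where
  Uᵉ Lᵉ : ℕ → EvenState
  Qᵉ    : EvenState

state : EvenState → State
state (Uᵉ j) = U (twice j)
state (Lᵉ j) = L (suc (twice j))
state Qᵉ     = Q

pathSum : ∀ {I : Set} → List (ℚ × ℚ × I) → (I → ℚ) → ℚ
pathSum []                  f = 0ℚ
pathSum ((p , q , i) ∷ ps) f = p * (q * f i) + pathSum ps f

pathSum-cong : ∀ {I : Set} ps {f g : I → ℚ} → (∀ i → f i ≡ g i) → pathSum ps f ≡ pathSum ps g
pathSum-cong []                  f≡g = refl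
pathSum-cong ((p , q , i) ∷ ps) f≡g = cong₂ _+_ (cong (λ x → p * (q * x)) (f≡g i)) (pathSum-cong ps f≡g)

module TwoStep (α : ℚ) where

  β : ℚ
  β = 1ℚ - α

  -- (p , q , y) ∈ paths x: the walk goes from y to x in two steps, with
  -- probabilities p and then q.
  paths : EvenState → List (ℚ × ℚ × EvenState)
  paths (Uᵉ zero)          = (α , α , Uᵉ 0) ∷ (β , α , Uᵉ 1) ∷ (β , α , Qᵉ) ∷ (β , β , Uᵉ 0) ∷ []
  paths (Uᵉ (suc zero))    = (α , β , Uᵉ 0) ∷ (β , β , Uᵉ 1) ∷ (β , β , Qᵉ) ∷ (α , α , Uᵉ 1) ∷ (β , α , Uᵉ 2) ∷ []
  paths (Uᵉ (suc (suc j))) = (α , β , Uᵉ (1 ℕ.+ j)) ∷ (β , β , Uᵉ (2 ℕ.+ j)) ∷ (α , α , Uᵉ (2 ℕ.+ j)) ∷ (β , α , Uᵉ (3 ℕ.+ j)) ∷ []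
  paths Qᵉ                 = (β , α , Lᵉ 0) ∷ (α , α , Qᵉ) ∷ []
  paths (Lᵉ zero)          = (β , β , Lᵉ 0) ∷ (α , β , Qᵉ) ∷ (α , α , Lᵉ 0) ∷ (β , α , Lᵉ 1) ∷ (β , α , Uᵉ 0) ∷ []
  paths (Lᵉ (suc j))       = (α , β , Lᵉ j) ∷ (β , β , Lᵉ (1 ℕ.+ j)) ∷ (α , α , Lᵉ (1 ℕ.+ j)) ∷ (β , α , Lᵉ (2 ℕ.+ j)) ∷ []

  open +-*-Solver

  -- When s has out-edges (t₁ , p) ∷ (t₂ , q) ∷ [], reach α 1 s t unfolds to
  -- p * [ t₁ ≟ t ] + (q * [ t₂ ≟ t ] + 0); these are the two unfoldings for t = t₁, t₂.
  viaFirst viaSecond : ∀ {k} → Polynomial k → Polynomial k → Polynomial k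
  viaFirst  p q = p :* con 1ℚ :+ (q :* con 0ℚ :+ con 0ℚ)
  viaSecond p q = p :* con 0ℚ :+ (q :* con 1ℚ :+ con 0ℚ)

  reach-two-steps : ∀ n s x → reach α (suc (suc n)) s (state x) ≡ pathSum (paths x) (λ y → reach α n s (state y))
  reach-two-steps n s (Uᵉ zero) rewrite reach-two-backward α n s (U 0) =
    solve 4 (λ a x₀ x₁ x_q → let b = con 1ℚ :- a in
      (x₀ :* viaFirst a b :+ (x₁ :* viaSecond a b :+ (x_q :* viaSecond a b :+ con 0ℚ))) :* viaSecond b a
        :+ ((x₀ :* viaSecond a b :+ con 0ℚ) :* viaFirst b a :+ con 0ℚ)
      := a :* (a :* x₀) :+ (b :* (a :* x₁) :+ (b :* (a :* x_q) :+ (b :* (b :* x₀) :+ con 0ℚ))))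
      refl α (reach α n s (U 0)) (reach α n s (U 2)) (reach α n s Q)
  reach-two-steps n s (Uᵉ (suc zero)) rewrite reach-two-backward α n s (U 2) =
    solve 5 (λ a x₀ x₁ x₂ x_q → let b = con 1ℚ :- a in
      (x₀ :* viaFirst a b :+ (x₁ :* viaSecond a b :+ (x_q :* viaSecond a b :+ con 0ℚ))) :* viaFirst b a
        :+ ((x₁ :* viaFirst a b :+ (x₂ :* viaSecond a b :+ con 0ℚ)) :* viaSecond b a :+ con 0ℚ)
      := a :* (b :* x₀) :+ (b :* (b :* x₁) :+ (b :* (b :* x_q) :+ (a :* (a :* x₁) :+ (b :* (a :* x₂) :+ con 0ℚ)))))
      refl α (reach α n s (U 0)) (reach α n s (U 2)) (reach α n s (U 4)) (reach α n s Q)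
  reach-two-steps n s (Uᵉ (suc (suc j)))
    rewrite reach-two-backward α n s (U (twice (2 ℕ.+ j))) | isEven-twice j
          | eqℕ-refl (twice j) | eqℕ-n-2+n (twice j) | eqℕ-2+n-n (twice j) =
    solve 4 (λ a x₁ x₂ x₃ → let b = con 1ℚ :- a in
      (x₁ :* viaFirst a b :+ (x₂ :* viaSecond a b :+ con 0ℚ)) :* viaFirst b a
        :+ ((x₂ :* viaFirst a b :+ (x₃ :* viaSecond a b :+ con 0ℚ)) :* viaSecond b a :+ con 0ℚ)
      := a :* (b :* x₁) :+ (b :* (b :* x₂) :+ (a :* (a :* x₂) :+ (b :* (a :* x₃) :+ con 0ℚ))))
      refl α (reach α n s (U (twice (1 ℕ.+ j)))) (reach α n s (U (twice (2 ℕ.+ j)))) (reach α n s (U (twice (3 ℕ.+ j))))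
  reach-two-steps n s Qᵉ rewrite reach-two-backward α n s Q =
    solve 3 (λ a y₀ x_q → let b = con 1ℚ :- a in
      (y₀ :* viaSecond a b :+ (x_q :* viaFirst a b :+ con 0ℚ)) :* viaSecond b a :+ con 0ℚ
      := b :* (a :* y₀) :+ (a :* (a :* x_q) :+ con 0ℚ))
      refl α (reach α n s (L 1)) (reach α n s Q)
  reach-two-steps n s (Lᵉ zero) rewrite reach-two-backward α n s (L 1) =
    solve 5 (λ a y₀ y₁ x_q x₀ → let b = con 1ℚ :- a in
      (y₀ :* viaSecond a b :+ (x_q :* viaFirst a b :+ con 0ℚ)) :* viaFirst b a
        :+ ((y₀ :* viaFirst a b :+ (y₁ :* viaSecond a b :+ con 0ℚ)) :* viaSecond b a
        :+ ((x₀ :* viaSecond a b :+ con 0ℚ) :* viaSecond b a :+ con 0ℚ))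
      := b :* (b :* y₀) :+ (a :* (b :* x_q) :+ (a :* (a :* y₀) :+ (b :* (a :* y₁) :+ (b :* (a :* x₀) :+ con 0ℚ)))))
      refl α (reach α n s (L 1)) (reach α n s (L 3)) (reach α n s Q) (reach α n s (U 0))
  reach-two-steps n s (Lᵉ (suc j))
    rewrite reach-two-backward α n s (L (suc (twice (suc j)))) | isEven-twice j
          | eqℕ-refl (twice j) | eqℕ-n-2+n (twice j) | eqℕ-2+n-n (twice j) =
    solve 4 (λ a y₀ y₁ y₂ → let b = con 1ℚ :- a in
      (y₀ :* viaFirst a b :+ (y₁ :* viaSecond a b :+ con 0ℚ)) :* viaFirst b a
        :+ ((y₁ :* viaFirst a b :+ (y₂ :* viaSecond a b :+ con 0ℚ)) :* viaSecond b a :+ con 0ℚ)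
      := a :* (b :* y₀) :+ (b :* (b :* y₁) :+ (a :* (a :* y₁) :+ (b :* (a :* y₂) :+ con 0ℚ))))
      refl α (reach α n s (L (suc (twice j)))) (reach α n s (L (suc (twice (suc j))))) (reach α n s (L (suc (twice (2 ℕ.+ j)))))

-- Linear systems over two-step paths

module PathSystem {I : Set} (paths : I → List (ℚ × ℚ × I)) where

  pathSumₛ : List (ℚ × ℚ × I) → (I → Series) → Series
  pathSumₛ []                  S = constₛ 0ℚ
  pathSumₛ ((p , q , i) ∷ ps) S = constₛ p *ₛ (constₛ q *ₛ S i) +ₛ pathSumₛ ps S

  pathSumₛ-coeff : ∀ ps S n → pathSumₛ ps S n ≡ pathSum ps (λ i → S i n)
  pathSumₛ-coeff []                  S zero    = refl
  pathSumₛ-coeff []                  S (suc n) = refl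
  pathSumₛ-coeff ((p , q , i) ∷ ps) S n =
    cong₂ _+_ (≡.trans (constₛ-*ₛ p (constₛ q *ₛ S i) n) (cong (p *_) (constₛ-*ₛ q (S i) n))) (pathSumₛ-coeff ps S n)

  record Solves (s S : I → Series) : Set where
    constructor solves
    field equation : ∀ i → S i ≈ s i +ₛ zₛ *ₛ pathSumₛ (paths i) S

  Solves⇒initial : ∀ {s S} → Solves s S → ∀ i → S i 0 ≡ s i 0 + 0ℚ
  Solves⇒initial {s} {S} (solves sol) i = ≡.trans (sol i 0) (cong (s i 0 +_) (zₛ-*ₛ-zero (pathSumₛ (paths i) S)))

  Solves⇒recurrence : ∀ {s S} → Solves s S → ∀ i n → S i (suc n) ≡ s i (suc n) + pathSum (paths i) (λ j → S j n)
  Solves⇒recurrence {s} {S} (solves sol) i n = ≡.trans (sol i (suc n))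
    (cong (s i (suc n) +_) (≡.trans (zₛ-*ₛ-suc (pathSumₛ (paths i) S) n) (pathSumₛ-coeff (paths i) S n)))

  solution-unique : ∀ {s S S′} → Solves s S → Solves s S′ → ∀ n i → S i n ≡ S′ i n
  solution-unique sol sol′ zero i = ≡.trans (Solves⇒initial sol i) (≡.sym (Solves⇒initial sol′ i))
  solution-unique {s} {S} {S′} sol sol′ (suc n) i = begin
    S i (suc n)                                     ≡⟨ Solves⇒recurrence sol i n ⟩
    s i (suc n) + pathSum (paths i) (λ j → S j n)   ≡⟨ cong (s i (suc n) +_) (pathSum-cong (paths i) (λ j → solution-unique sol sol′ n j)) ⟩
    s i (suc n) + pathSum (paths i) (λ j → S′ j n)  ≡⟨ Solves⇒recurrence sol′ i n ⟨
    S′ i (suc n)                                    ∎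
    where open ≡.≡-Reasoning

  recurrence⇒Solves : ∀ (s₀ : I → ℚ) S → (∀ i → S i 0 ≡ s₀ i) →
    (∀ i n → S i (suc n) ≡ pathSum (paths i) (λ j → S j n)) → Solves (λ i → constₛ (s₀ i)) S
  recurrence⇒Solves s₀ S initial recurrence = solves equation
    where
    equation : ∀ i → S i ≈ constₛ (s₀ i) +ₛ zₛ *ₛ pathSumₛ (paths i) S
    equation i zero = begin
      S i 0                                       ≡⟨ initial i ⟩
      s₀ i                                        ≡⟨ ℚ.+-identityʳ (s₀ i) ⟨
      s₀ i + 0ℚ                                   ≡⟨ cong (s₀ i +_) (zₛ-*ₛ-zero (pathSumₛ (paths i) S)) ⟨
      s₀ i + (zₛ *ₛ pathSumₛ (paths i) S) 0       ∎
      where open ≡.≡-Reasoning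
    equation i (suc n) = begin
      S i (suc n)                                 ≡⟨ recurrence i n ⟩
      pathSum (paths i) (λ j → S j n)             ≡⟨ pathSumₛ-coeff (paths i) S n ⟨
      pathSumₛ (paths i) S n                      ≡⟨ zₛ-*ₛ-suc (pathSumₛ (paths i) S) n ⟨
      (zₛ *ₛ pathSumₛ (paths i) S) (suc n)        ≡⟨ ℚ.+-identityˡ _ ⟨
      0ℚ + (zₛ *ₛ pathSumₛ (paths i) S) (suc n)   ∎
      where open ≡.≡-Reasoning

  module _ where
    open CommutativeRing Series-ring using (setoid)
    open import Relation.Binary.Reasoning.Setoid setoid
    open SeriesSolver using (solve; _:=_; _:+_; _:*_; con)

    pathSumₛ-*ₛ : ∀ ps S c → c *ₛ pathSumₛ ps S ≈ pathSumₛ ps (λ i → c *ₛ S i)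
    pathSumₛ-*ₛ []                  S c = solve 1 (λ c → c :* con 0ℚ := con 0ℚ) (λ _ → refl) c
    pathSumₛ-*ₛ ((p , q , i) ∷ ps) S c = begin
      c *ₛ (constₛ p *ₛ (constₛ q *ₛ S i) +ₛ pathSumₛ ps S)
        ≈⟨ solve 5 (λ c p q x r → c :* (p :* (q :* x) :+ r) := p :* (q :* (c :* x)) :+ c :* r) (λ _ → refl)
                   c (constₛ p) (constₛ q) (S i) (pathSumₛ ps S) ⟩
      constₛ p *ₛ (constₛ q *ₛ (c *ₛ S i)) +ₛ c *ₛ pathSumₛ ps S
        ≈⟨ +ₛ-congˡ (constₛ p *ₛ (constₛ q *ₛ (c *ₛ S i))) (pathSumₛ-*ₛ ps S c) ⟩
      constₛ p *ₛ (constₛ q *ₛ (c *ₛ S i)) +ₛ pathSumₛ ps (λ i → c *ₛ S i) ∎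

    Solves-*ₛ : ∀ {s S} c → Solves s S → Solves (λ i → c *ₛ s i) (λ i → c *ₛ S i)
    Solves-*ₛ {s} {S} c (solves sol) = solves λ i → begin
      c *ₛ S i                                          ≈⟨ *ₛ-congˡ c (sol i) ⟩
      c *ₛ (s i +ₛ zₛ *ₛ pathSumₛ (paths i) S)          ≈⟨ solve 4 (λ c s z l → c :* (s :+ z :* l) := c :* s :+ z :* (c :* l)) (λ _ → refl)
                                                             c (s i) zₛ (pathSumₛ (paths i) S) ⟩
      c *ₛ s i +ₛ zₛ *ₛ (c *ₛ pathSumₛ (paths i) S)     ≈⟨ +ₛ-congˡ (c *ₛ s i) (*ₛ-congˡ zₛ (pathSumₛ-*ₛ (paths i) S c)) ⟩
      c *ₛ s i +ₛ zₛ *ₛ pathSumₛ (paths i) (λ j → c *ₛ S j) ∎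

col : ℕ → Series2 → Series
col j Y m = Y m j

col-lift-*₂ : ∀ a Y j → col j (lift a *₂ Y) ≈ a *ₛ col j Y
col-lift-*₂ a Y j m = Ser.∑-cong m (λ k → ≡.trans (Ser.*ˢ-congʳ (Y (m ℕ.∸ k)) (lift≈constₛ k) j) (constₛ-*ₛ (a k) (Y (m ℕ.∸ k)) j))
  where
  lift≈constₛ : ∀ k l → lift a k l ≡ constₛ (a k) l
  lift≈constₛ k zero    = refl
  lift≈constₛ k (suc l) = refl

u₂-*₂ : ∀ Y m → (λ j → (u₂ *₂ Y) m j) ≈ zₛ *ₛ Y m
u₂-*₂ Y m j = ≡.trans (Ser₂.*ˢ-congʳ Y u₂≈κz m j) (Ser₂.κ-*ˢ zₛ Y m j)
  where
  u₂≈κz : u₂ ≈₂ Ser₂.κ zₛ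
  u₂≈κz zero    zero          = refl
  u₂≈κz zero    (suc zero)    = refl
  u₂≈κz zero    (suc (suc l)) = refl
  u₂≈κz (suc k) zero          = refl
  u₂≈κz (suc k) (suc l)       = refl

col-lift : ∀ a j → col (suc j) (lift a) ≈ constₛ 0ℚ
col-lift a j zero    = refl
col-lift a j (suc m) = refl

lift-*ₛ : ∀ a b → lift (a *ₛ b) ≈₂ lift a *₂ lift b
lift-*ₛ a b m zero    = refl
lift-*ₛ a b m (suc j) = ≡.sym (begin
  (lift a *₂ lift b) m (suc j)         ≡⟨ col-lift-*₂ a (lift b) (suc j) m ⟩
  (a *ₛ col (suc j) (lift b)) m        ≡⟨ Ser.∑-zeros m (λ k → ℚ.*-zeroʳ (a k)) ⟩
  0ℚ                                   ∎)
  where open ≡.≡-Reasoning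

col-lift+u-zero : ∀ a b → col 0 (lift a +₂ u₂ *₂ lift b) ≈ a
col-lift+u-zero a b m = ≡.trans (cong (a m +_) (≡.trans (u₂-*₂ (lift b) m 0) (zₛ-*ₛ-zero (lift b m)))) (ℚ.+-identityʳ (a m))

col-lift+u-suc : ∀ a b j → col (suc j) (lift a +₂ u₂ *₂ lift b) ≈ col j (lift b)
col-lift+u-suc a b j m = ≡.trans (cong (0ℚ +_) (≡.trans (u₂-*₂ (lift b) m (suc j)) (zₛ-*ₛ-suc (lift b m) j))) (ℚ.+-identityˡ _)

data Poly : Set where
  vᴾ       : Poly
  ↑_       : ℚ → Poly
  _⊕_ _⊗_  : Poly → Poly → Poly
  ⊝_       : Poly → Poly

infixl 6 _⊕_
infixl 7 _⊗_

⟦_⟧₁ : Poly → Series → Series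
⟦ vᴾ ⟧₁    v = v
⟦ ↑ x ⟧₁  v = constₛ x
⟦ e ⊕ e′ ⟧₁ v = ⟦ e ⟧₁ v +ₛ ⟦ e′ ⟧₁ v
⟦ e ⊗ e′ ⟧₁ v = ⟦ e ⟧₁ v *ₛ ⟦ e′ ⟧₁ v
⟦ ⊝ e ⟧₁   v = λ n → ℚ.- ⟦ e ⟧₁ v n

⟦_⟧₂ : Poly → Series → Series2
⟦ vᴾ ⟧₂     v = lift v
⟦ ↑ x ⟧₂   v = const₂ x
⟦ e ⊕ e′ ⟧₂ v = ⟦ e ⟧₂ v +₂ ⟦ e′ ⟧₂ v
⟦ e ⊗ e′ ⟧₂ v = ⟦ e ⟧₂ v *₂ ⟦ e′ ⟧₂ v
⟦ ⊝ e ⟧₂    v = λ m j → - ⟦ e ⟧₂ v m j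

lift-⟦⟧ : ∀ e v → lift (⟦ e ⟧₁ v) ≈₂ ⟦ e ⟧₂ v
lift-⟦⟧ vᴾ       v m j       = refl
lift-⟦⟧ (↑ x)   v zero    zero    = refl
lift-⟦⟧ (↑ x)   v zero    (suc j) = refl
lift-⟦⟧ (↑ x)   v (suc m) zero    = refl
lift-⟦⟧ (↑ x)   v (suc m) (suc j) = refl
lift-⟦⟧ (e ⊕ e′) v m zero    = cong₂ _+_ (lift-⟦⟧ e v m 0) (lift-⟦⟧ e′ v m 0)
lift-⟦⟧ (e ⊕ e′) v m (suc j) = cong₂ _+_ (lift-⟦⟧ e v m (suc j)) (lift-⟦⟧ e′ v m (suc j))
lift-⟦⟧ (e ⊗ e′) v m j = ≡.trans (lift-*ₛ (⟦ e ⟧₁ v) (⟦ e′ ⟧₁ v) m j) (Ser₂.*ˢ-cong (lift-⟦⟧ e v) (lift-⟦⟧ e′ v) m j)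
lift-⟦⟧ (⊝ e)    v m zero    = cong -_ (lift-⟦⟧ e v m 0)
lift-⟦⟧ (⊝ e)    v m (suc j) = cong -_ (lift-⟦⟧ e v m (suc j))

-- The explicit solution

module Candidate (α : ℚ) (v : Series)
  (v-eq : ∀ n → v n ≡ (zₛ *ₛ (constₛ α +ₛ constₛ (1ℚ - α) *ₛ v) *ₛ (constₛ (1ℚ - α) +ₛ constₛ α *ₛ v)) n)
  where

  open TwoStep α
  open PathSystem paths
  open CommutativeRing Series-ring using (sym; *-assoc)

  scaling numF₀ numF₁ numG : Poly
  scaling = ↑ (α ℚ.* β) ⊗ (↑ 1ℚ ⊕ ⊝ vᴾ) ⊗ (vᴾ ⊗ vᴾ ⊕ vᴾ ⊕ ↑ 1ℚ)
  numF₀   = (↑ α ⊕ vᴾ ⊗ ↑ β) ⊗ (vᴾ ⊗ ↑ α ⊕ ↑ β)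
  numF₁   = vᴾ ⊗ vᴾ ⊗ vᴾ ⊗ ↑ β ⊗ (vᴾ ⊗ ↑ α ⊕ ↑ β)
  numG    = vᴾ ⊗ (↑ α ⊕ ↑ α ⊗ vᴾ ⊗ vᴾ ⊕ vᴾ ⊗ ↑ β) ⊗ (vᴾ ⊗ ↑ α ⊕ ↑ β)

  c p₀ p₁ q₀ : Series
  c  = ⟦ scaling ⟧₁ v
  p₀ = ⟦ numF₀ ⟧₁ v
  p₁ = ⟦ numF₁ ⟧₁ v
  q₀ = ⟦ numG ⟧₁ v

  vpow : ℕ → Series
  vpow zero    = constₛ 1ℚ
  vpow (suc j) = v *ₛ vpow j

  candidate : EvenState → Series
  candidate (Uᵉ zero)    = p₀
  candidate (Uᵉ (suc j)) = vpow j *ₛ (v *ₛ p₀ +ₛ p₁)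
  candidate (Lᵉ j)       = vpow j *ₛ q₀
  candidate Qᵉ           = constₛ α *ₛ v *ₛ v *ₛ (v *ₛ constₛ α +ₛ constₛ β)

  source : EvenState → ℚ
  source (Uᵉ zero)    = 1ℚ
  source (Uᵉ (suc _)) = 0ℚ
  source (Lᵉ _)       = 0ℚ
  source Qᵉ           = 0ℚ

  α̂ β̂ w : Series
  α̂ = constₛ α
  β̂ = constₛ β
  w = (α̂ +ₛ β̂ *ₛ v) *ₛ (β̂ +ₛ α̂ *ₛ v)

  v≈zw : v ≈ zₛ *ₛ w
  v≈zw n = ≡.trans (v-eq n) (*-assoc zₛ (α̂ +ₛ β̂ *ₛ v) (β̂ +ₛ α̂ *ₛ v) n)

  open SeriesSolver using (Polynomial; var; con; _:+_; _:*_; _:-_; ⟦_⟧; prove)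

  𝑎 𝑏 𝑣 𝑤 : Polynomial 4
  𝑎 = var zero
  𝑏 = var (suc zero)
  𝑣 = var (suc (suc zero))
  𝑤 = var (suc (suc (suc zero)))

  env : ℕ → Vec Series 4
  env j = α̂ ∷ β̂ ∷ v ∷ vpow j ∷ []

  𝑐 𝑝₀ 𝑝₁ 𝑞₀ 𝑟 𝑊 : Polynomial 4
  𝑐  = 𝑎 :* 𝑏 :* (con 1ℚ :- 𝑣) :* (𝑣 :* 𝑣 :+ 𝑣 :+ con 1ℚ)
  𝑝₀ = (𝑎 :+ 𝑣 :* 𝑏) :* (𝑣 :* 𝑎 :+ 𝑏)
  𝑝₁ = 𝑣 :* 𝑣 :* 𝑣 :* 𝑏 :* (𝑣 :* 𝑎 :+ 𝑏)
  𝑞₀ = 𝑣 :* (𝑎 :+ 𝑎 :* 𝑣 :* 𝑣 :+ 𝑣 :* 𝑏) :* (𝑣 :* 𝑎 :+ 𝑏)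
  𝑟  = 𝑎 :* 𝑣 :* 𝑣 :* (𝑣 :* 𝑎 :+ 𝑏)
  𝑊  = (𝑎 :+ 𝑏 :* 𝑣) :* (𝑏 :+ 𝑎 :* 𝑣)

  c-split : c ≈ ⟦ 𝑐 ⟧ (env 0)
  c-split = *ₛ-congʳ (⟦ vᴾ ⊗ vᴾ ⊕ vᴾ ⊕ ↑ 1ℚ ⟧₁ v) (*ₛ-congʳ (⟦ ↑ 1ℚ ⊕ ⊝ vᴾ ⟧₁ v)
              (_-Raw-AlmostCommutative⟶_.*-homo constₛ-morphism α β))

  -- As v = z w, the equation at x follows from two polynomial identities in
  -- α, β, v: candidate x = c · source x + q v and pathSumₛ (paths x) candidate = q w.
  by-substitution : ∀ x j (𝑞 : Polynomial 4) →
    candidate x ≈ ⟦ 𝑐 ⟧ (env j) *ₛ constₛ (source x) +ₛ ⟦ 𝑞 ⟧ (env j) *ₛ v →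
    pathSumₛ (paths x) candidate ≈ ⟦ 𝑞 ⟧ (env j) *ₛ w →
    candidate x ≈ c *ₛ constₛ (source x) +ₛ zₛ *ₛ pathSumₛ (paths x) candidate
  by-substitution x j 𝑞 x≈cs+qv =
    substitution Series-ring {v} {zₛ} {w} (candidate x) (c *ₛ constₛ (source x)) (⟦ 𝑞 ⟧ (env j)) (pathSumₛ (paths x) candidate) v≈zw
      (λ n → ≡.trans (x≈cs+qv n) (+ₛ-congʳ (⟦ 𝑞 ⟧ (env j) *ₛ v) (*ₛ-congʳ (constₛ (source x)) (sym c-split)) n))

  candidate-solves : Solves (λ i → c *ₛ constₛ (source i)) candidate
  candidate-solves = solves equation
    where
    equation : ∀ x → candidate x ≈ c *ₛ constₛ (source x) +ₛ zₛ *ₛ pathSumₛ (paths x) candidate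
    equation (Uᵉ zero) = by-substitution (Uᵉ zero) 0 𝑞
      (prove (env 0) 𝑝₀ (𝑐 :* con 1ℚ :+ 𝑞 :* 𝑣) (λ _ → refl))
      (prove (env 0) (𝑎 :* (𝑎 :* 𝑝₀) :+ (𝑏 :* (𝑎 :* (con 1ℚ :* (𝑣 :* 𝑝₀ :+ 𝑝₁))) :+ (𝑏 :* (𝑎 :* 𝑟) :+ (𝑏 :* (𝑏 :* 𝑝₀) :+ con 0ℚ))))
                     (𝑞 :* 𝑊) (λ _ → refl))
      where
      𝑞 = 𝑎 :* 𝑎 :+ 𝑏 :* 𝑏 :+ 𝑎 :* 𝑏 :* 𝑣 :+ 𝑎 :* 𝑏 :* 𝑣 :* 𝑣
    equation (Uᵉ (suc zero)) = by-substitution (Uᵉ 1) 0 𝑞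
      (prove (env 0) (con 1ℚ :* (𝑣 :* 𝑝₀ :+ 𝑝₁)) (𝑐 :* con 0ℚ :+ 𝑞 :* 𝑣) (λ _ → refl))
      (prove (env 0) (𝑎 :* (𝑏 :* 𝑝₀) :+ (𝑏 :* (𝑏 :* (con 1ℚ :* (𝑣 :* 𝑝₀ :+ 𝑝₁))) :+ (𝑏 :* (𝑏 :* 𝑟)
                        :+ (𝑎 :* (𝑎 :* (con 1ℚ :* (𝑣 :* 𝑝₀ :+ 𝑝₁))) :+ (𝑏 :* (𝑎 :* ((𝑣 :* con 1ℚ) :* (𝑣 :* 𝑝₀ :+ 𝑝₁))) :+ con 0ℚ)))))
                     (𝑞 :* 𝑊) (λ _ → refl))
      where
      𝑞 = con 1ℚ :* (𝑝₀ :+ 𝑣 :* 𝑣 :* 𝑏 :* (𝑣 :* 𝑎 :+ 𝑏))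
    equation (Uᵉ (suc (suc j))) = by-substitution (Uᵉ (2 ℕ.+ j)) j 𝑞
      (prove (env j) ((𝑣 :* 𝑤) :* (𝑣 :* 𝑝₀ :+ 𝑝₁)) (𝑐 :* con 0ℚ :+ 𝑞 :* 𝑣) (λ _ → refl))
      (prove (env j) (𝑎 :* (𝑏 :* (𝑤 :* (𝑣 :* 𝑝₀ :+ 𝑝₁))) :+ (𝑏 :* (𝑏 :* ((𝑣 :* 𝑤) :* (𝑣 :* 𝑝₀ :+ 𝑝₁)))
                        :+ (𝑎 :* (𝑎 :* ((𝑣 :* 𝑤) :* (𝑣 :* 𝑝₀ :+ 𝑝₁))) :+ (𝑏 :* (𝑎 :* ((𝑣 :* (𝑣 :* 𝑤)) :* (𝑣 :* 𝑝₀ :+ 𝑝₁))) :+ con 0ℚ))))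
                     (𝑞 :* 𝑊) (λ _ → refl))
      where
      𝑞 = (𝑣 :* 𝑤) :* (𝑝₀ :+ 𝑣 :* 𝑣 :* 𝑏 :* (𝑣 :* 𝑎 :+ 𝑏))
    equation Qᵉ = by-substitution Qᵉ 0 𝑞
      (prove (env 0) 𝑟 (𝑐 :* con 0ℚ :+ 𝑞 :* 𝑣) (λ _ → refl))
      (prove (env 0) (𝑏 :* (𝑎 :* (con 1ℚ :* 𝑞₀)) :+ (𝑎 :* (𝑎 :* 𝑟) :+ con 0ℚ)) (𝑞 :* 𝑊) (λ _ → refl))
      where
      𝑞 = 𝑎 :* 𝑣 :* (𝑣 :* 𝑎 :+ 𝑏)
    equation (Lᵉ zero) = by-substitution (Lᵉ 0) 0 𝑞
      (prove (env 0) (con 1ℚ :* 𝑞₀) (𝑐 :* con 0ℚ :+ 𝑞 :* 𝑣) (λ _ → refl))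
      (prove (env 0) (𝑏 :* (𝑏 :* (con 1ℚ :* 𝑞₀)) :+ (𝑎 :* (𝑏 :* 𝑟) :+ (𝑎 :* (𝑎 :* (con 1ℚ :* 𝑞₀))
                        :+ (𝑏 :* (𝑎 :* ((𝑣 :* con 1ℚ) :* 𝑞₀)) :+ (𝑏 :* (𝑎 :* 𝑝₀) :+ con 0ℚ)))))
                     (𝑞 :* 𝑊) (λ _ → refl))
      where
      𝑞 = con 1ℚ :* (𝑎 :+ 𝑎 :* 𝑣 :* 𝑣 :+ 𝑣 :* 𝑏) :* (𝑣 :* 𝑎 :+ 𝑏)
    equation (Lᵉ (suc j)) = by-substitution (Lᵉ (suc j)) j 𝑞
      (prove (env j) ((𝑣 :* 𝑤) :* 𝑞₀) (𝑐 :* con 0ℚ :+ 𝑞 :* 𝑣) (λ _ → refl))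
      (prove (env j) (𝑎 :* (𝑏 :* (𝑤 :* 𝑞₀)) :+ (𝑏 :* (𝑏 :* ((𝑣 :* 𝑤) :* 𝑞₀)) :+ (𝑎 :* (𝑎 :* ((𝑣 :* 𝑤) :* 𝑞₀))
                        :+ (𝑏 :* (𝑎 :* ((𝑣 :* (𝑣 :* 𝑤)) :* 𝑞₀)) :+ con 0ℚ))))
                     (𝑞 :* 𝑊) (λ _ → refl))
      where
      𝑞 = (𝑣 :* 𝑤) :* (𝑎 :+ 𝑎 :* 𝑣 :* 𝑣 :+ 𝑣 :* 𝑏) :* (𝑣 :* 𝑎 :+ 𝑏)

module Assembly (α : ℚ) (v : Series)
  (v-eq : ∀ n → v n ≡ (zₛ *ₛ (constₛ α +ₛ constₛ (1ℚ - α) *ₛ v) *ₛ (constₛ (1ℚ - α) +ₛ constₛ α *ₛ v)) n)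
  where

  open Candidate α v v-eq
  open TwoStep α using (β; paths; reach-two-steps)
  open PathSystem paths
  open CommutativeRing Series-ring using (setoid) renaming (_-_ to _-ₛ_)
  open CommutativeRing Series2-ring using () renaming (sym to sym₂)

  gf : EvenState → Series
  gf x m = reach α (twice m) (U 0) (state x)

  gf-solves : Solves (λ x → constₛ (source x)) gf
  gf-solves = recurrence⇒Solves source gf initial (λ x m → reach-two-steps (twice m) (U 0) x)
    where
    initial : ∀ x → gf x 0 ≡ source x
    initial (Uᵉ zero)    = refl
    initial (Uᵉ (suc j)) = refl
    initial (Lᵉ j)       = refl
    initial Qᵉ           = refl

  scaled-gf : ∀ x → c *ₛ gf x ≈ candidate x
  scaled-gf x m = solution-unique (Solves-*ₛ c gf-solves) candidate-solves m x

  V D : Series2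
  V = lift v
  D = const₂ (α ℚ.* β) *₂ (const₂ 1ℚ -₂ u₂ *₂ V) *₂ (const₂ 1ℚ -₂ V) *₂ (V *₂ V +₂ V +₂ const₂ 1ℚ)

  col-*₂-D : ∀ Y j → col j (Y *₂ D) ≈ c *ₛ col j (Y -₂ u₂ *₂ (V *₂ Y))
  col-*₂-D Y j m = ≡.trans (factor Y m j)
    (≡.trans (Ser₂.*ˢ-congʳ (Y -₂ u₂ *₂ (V *₂ Y)) (sym₂ (lift-⟦⟧ scaling v)) m j)
             (col-lift-*₂ c (Y -₂ u₂ *₂ (V *₂ Y)) j m))
    where
    open Series2Solver using (solve; _:=_; _:+_; _:*_; _:-_; con)
    factor : ∀ Y → Y *₂ D ≈₂ ⟦ scaling ⟧₂ v *₂ (Y -₂ u₂ *₂ (V *₂ Y))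
    factor Y = solve 4 (λ y u w k →
        y :* (k :* (con 1ℚ :- u :* w) :* (con 1ℚ :- w) :* (w :* w :+ w :+ con 1ℚ))
        := (k :* (con 1ℚ :- w) :* (w :* w :+ w :+ con 1ℚ)) :* (y :- u :* (w :* y)))
        (λ _ _ → refl) Y u₂ V (const₂ (α ℚ.* β))

  col-1-uV-zero : ∀ Y → col 0 (Y -₂ u₂ *₂ (V *₂ Y)) ≈ col 0 Y
  col-1-uV-zero Y m = ≡.trans (cong (λ x → Y m 0 - x) (≡.trans (u₂-*₂ (V *₂ Y) m 0) (zₛ-*ₛ-zero ((V *₂ Y) m))))
                              (ℚ.+-identityʳ (Y m 0))

  col-1-uV-suc : ∀ Y j → col (suc j) (Y -₂ u₂ *₂ (V *₂ Y)) ≈ col (suc j) Y -ₛ v *ₛ col j Y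
  col-1-uV-suc Y j m = cong (λ x → Y m (suc j) - x)
    (≡.trans (u₂-*₂ (V *₂ Y) m (suc j)) (≡.trans (zₛ-*ₛ-suc ((V *₂ Y) m) j) (col-lift-*₂ v Y j m)))

  module ColumnsOf (Y : Series2) (xs : ℕ → EvenState) (col-Y : ∀ j → col j Y ≈ gf (xs j)) where
    open import Relation.Binary.Reasoning.Setoid setoid

    first-column : col 0 (Y *₂ D) ≈ candidate (xs 0)
    first-column = begin
      col 0 (Y *₂ D)                        ≈⟨ col-*₂-D Y 0 ⟩
      c *ₛ col 0 (Y -₂ u₂ *₂ (V *₂ Y))      ≈⟨ *ₛ-congˡ c (col-1-uV-zero Y) ⟩
      c *ₛ col 0 Y                          ≈⟨ *ₛ-congˡ c (col-Y 0) ⟩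
      c *ₛ gf (xs 0)                        ≈⟨ scaled-gf (xs 0) ⟩
      candidate (xs 0)                      ∎

    next-column : ∀ j → col (suc j) (Y *₂ D) ≈ candidate (xs (suc j)) -ₛ v *ₛ candidate (xs j)
    next-column j = begin
      col (suc j) (Y *₂ D)                                  ≈⟨ col-*₂-D Y (suc j) ⟩
      c *ₛ col (suc j) (Y -₂ u₂ *₂ (V *₂ Y))                ≈⟨ *ₛ-congˡ c (col-1-uV-suc Y j) ⟩
      c *ₛ (col (suc j) Y -ₛ v *ₛ col j Y)                  ≈⟨ distribute (col (suc j) Y) (col j Y) ⟩
      c *ₛ col (suc j) Y -ₛ v *ₛ (c *ₛ col j Y)             ≈⟨ (λ m → cong₂ _-_ (scaled (suc j) m) (*ₛ-congˡ v (scaled j) m)) ⟩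
      candidate (xs (suc j)) -ₛ v *ₛ candidate (xs j)       ∎
      where
      scaled : ∀ k → c *ₛ col k Y ≈ candidate (xs k)
      scaled k m = ≡.trans (*ₛ-congˡ c (col-Y k) m) (scaled-gf (xs k) m)
      open SeriesSolver using (solve; _:=_; _:-_; _:*_)
      distribute : ∀ a b → c *ₛ (a -ₛ v *ₛ b) ≈ c *ₛ a -ₛ v *ₛ (c *ₛ b)
      distribute a b = solve 4 (λ c a v b → c :* (a :- v :* b) := c :* a :- v :* (c :* b)) (λ _ → refl) c a v b

  NF NG : Series2
  NF = (u₂ *₂ V *₂ V *₂ V *₂ const₂ β +₂ const₂ α +₂ V *₂ const₂ β) *₂ (V *₂ const₂ α +₂ const₂ β)
  NG = V *₂ (const₂ α +₂ const₂ α *₂ V *₂ V +₂ V *₂ const₂ β) *₂ (V *₂ const₂ α +₂ const₂ β)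

  NF-split : NF ≈₂ lift p₀ +₂ u₂ *₂ lift p₁
  NF-split m j = ≡.trans (expand m j)
    (cong₂ _+_ (≡.sym (lift-⟦⟧ numF₀ v m j)) (Ser₂.*ˢ-cong {u₂} {u₂} (λ _ _ → refl) (sym₂ (lift-⟦⟧ numF₁ v)) m j))
    where
    open Series2Solver using (solve; _:=_; _:+_; _:*_)
    expand : NF ≈₂ ⟦ numF₀ ⟧₂ v +₂ u₂ *₂ ⟦ numF₁ ⟧₂ v
    expand = solve 4 (λ u w a b →
        (u :* w :* w :* w :* b :+ a :+ w :* b) :* (w :* a :+ b)
        := (a :+ w :* b) :* (w :* a :+ b) :+ u :* (w :* w :* w :* b :* (w :* a :+ b)))
        (λ _ _ → refl) u₂ V (const₂ α) (const₂ β)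

  module _ where
    open SeriesSolver using (solve; _:=_; _:+_; _:-_; _:*_; con)

    candidate-U-step₀ : candidate (Uᵉ 1) -ₛ v *ₛ candidate (Uᵉ 0) ≈ p₁
    candidate-U-step₀ = solve 3 (λ v p q → con 1ℚ :* (v :* p :+ q) :- v :* p := q) (λ _ → refl) v p₀ p₁

    candidate-U-step : ∀ j → candidate (Uᵉ (2 ℕ.+ j)) -ₛ v *ₛ candidate (Uᵉ (1 ℕ.+ j)) ≈ constₛ 0ℚ
    candidate-U-step j = solve 3 (λ v w r → (v :* w) :* r :- v :* (w :* r) := con 0ℚ) (λ _ → refl)
                       v (vpow j) (v *ₛ p₀ +ₛ p₁)

    candidate-L₀ : candidate (Lᵉ 0) ≈ q₀
    candidate-L₀ = solve 1 (λ q → con 1ℚ :* q := q) (λ _ → refl) q₀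

    candidate-L-step : ∀ j → candidate (Lᵉ (1 ℕ.+ j)) -ₛ v *ₛ candidate (Lᵉ j) ≈ constₛ 0ℚ
    candidate-L-step j = solve 3 (λ v w r → (v :* w) :* r :- v :* (w :* r) := con 0ℚ) (λ _ → refl) v (vpow j) q₀

  2*≡twice : ∀ n → 2 ℕ.* n ≡ twice n
  2*≡twice zero    = refl
  2*≡twice (suc n) = cong suc (≡.trans (ℕ.+-suc n (n ℕ.+ 0)) (cong suc (2*≡twice n)))

  col-F : ∀ j → col j (Fgf α) ≈ gf (Uᵉ j)
  col-F j m rewrite 2*≡twice m | 2*≡twice j = refl

  col-G : ∀ j → col j (Ggf α) ≈ gf (Lᵉ j)
  col-G j m rewrite 2*≡twice m | 2*≡twice j = refl

  NF-column₀ : col 0 NF ≈ p₀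
  NF-column₀ m = ≡.trans (NF-split m 0) (col-lift+u-zero p₀ p₁ m)

  NF-column₁ : col 1 NF ≈ p₁
  NF-column₁ m = ≡.trans (NF-split m 1) (col-lift+u-suc p₀ p₁ 0 m)

  NF-column : ∀ j → col (2 ℕ.+ j) NF ≈ constₛ 0ℚ
  NF-column j m = ≡.trans (NF-split m (2 ℕ.+ j)) (≡.trans (col-lift+u-suc p₀ p₁ (suc j) m) (col-lift p₁ j m))

  NG-column₀ : col 0 NG ≈ q₀
  NG-column₀ m = ≡.sym (lift-⟦⟧ numG v m 0)

  NG-column : ∀ j → col (suc j) NG ≈ constₛ 0ℚ
  NG-column j m = ≡.trans (≡.sym (lift-⟦⟧ numG v m (suc j))) (col-lift q₀ j m)

  F-identity : ∀ m j → (Fgf α *₂ D) m j ≡ NF m j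
  F-identity m zero          = ≡.trans (first-column m) (≡.sym (NF-column₀ m))
    where open ColumnsOf (Fgf α) Uᵉ col-F
  F-identity m (suc zero)    = ≡.trans (next-column 0 m) (≡.trans (candidate-U-step₀ m) (≡.sym (NF-column₁ m)))
    where open ColumnsOf (Fgf α) Uᵉ col-F
  F-identity m (suc (suc j)) = ≡.trans (next-column (suc j) m) (≡.trans (candidate-U-step j m) (≡.sym (NF-column j m)))
    where open ColumnsOf (Fgf α) Uᵉ col-F

  G-identity : ∀ m j → (Ggf α *₂ D) m j ≡ NG m j
  G-identity m zero    = ≡.trans (first-column m) (≡.trans (candidate-L₀ m) (≡.sym (NG-column₀ m)))
    where open ColumnsOf (Ggf α) Lᵉ col-G
  G-identity m (suc j) = ≡.trans (next-column j m) (≡.trans (candidate-L-step j m) (≡.sym (NG-column j m)))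
    where open ColumnsOf (Ggf α) Lᵉ col-G

mainTheorem1 :
  (α : ℚ) → 0ℚ < α → α < 1ℚ →
  let β = 1ℚ - α in
  (v : Series) → v 0 ≡ 0ℚ →
  (∀ n → v n ≡ (zₛ *ₛ (constₛ α +ₛ constₛ β *ₛ v) *ₛ (constₛ β +ₛ constₛ α *ₛ v)) n) →
  let V = lift v
      D = const₂ (α * β) *₂ (const₂ 1ℚ -₂ u₂ *₂ V) *₂ (const₂ 1ℚ -₂ V)
            *₂ (V *₂ V +₂ V +₂ const₂ 1ℚ)
      NF = (u₂ *₂ V *₂ V *₂ V *₂ const₂ β +₂ const₂ α +₂ V *₂ const₂ β)
             *₂ (V *₂ const₂ α +₂ const₂ β)
      NG = V *₂ (const₂ α +₂ const₂ α *₂ V *₂ V +₂ V *₂ const₂ β)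
             *₂ (V *₂ const₂ α +₂ const₂ β)
  in (∀ m j → (Fgf α *₂ D) m j ≡ NF m j)
   × (∀ m j → (Ggf α *₂ D) m j ≡ NG m j)
mainTheorem1 α _ _ v _ v-eq = F-identity , G-identity
  where open Assembly α v v-eq
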